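{- Let $G=(V,E,w)$ be a connected weighted multigraph, let $S\subseteq V$, and let $\psi=\max_{v\in V}\mathrm{dist}(v,S)$. Then for every $x\in S$ and every $l\ge0$, \[ \mathrm{rad}_{C_S(l,x)}(x)\le \psi+2l . \]
   Context: Edge lengths are $d(e)=1/w(e)$ and $\mathrm{dist}(u,S)$ is the shortest-path distance in $G$ from $u$ to a vertex of $S$. The forward edges induced by $S$ are $F(S)=\{(u\to v):(u,v)\in E,\ \mathrm{dist}(u,S)+d(u,v)=\mathrm{dist}(v,S)\}$. The cone $C_S(l,x)$ is the set of vertices reachable from $x$ by a path in which the sum of the lengths of the traversed edges that are not (traversed as) forward edges in $F(S)$ is at most $l$. For $U\subseteq V$ and $x\in U$, $\mathrm{rad}_U(x)$ is the smallest $r$ such that every vertex of $U$ is within distance $r$ of $x$ in the induced subgraph $G(U)$.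
   Formalization: The edge weights and the parameter l are rational rather than real, so the edge lengths, the distances dist(u,S) and ψ are rational as well. -}

module Defs where

open import Data.Nat using (ℕ)
open import Data.Fin using (Fin)
open import Data.Fin.Subset using (Subset; _∈_)
open import Data.Product using (Σ; ∃; ∃-syntax; _×_; _,_; proj₁; proj₂)
open import Data.Sum using (_⊎_)
open import Data.Rational using (ℚ; 0ℚ; _+_; _≤_; _<_; 1/_; >-nonZero)
open import Relation.Binary.PropositionalEquality using (_≡_)
import Data.Empty

-- A finite weighted multigraph G = (V, E, w): vertices Fin n, edges Fin m,
-- each edge has an (unordered) pair of endpoints and a positive weight.
-- Parallel edges (and loops) are allowed.
record Graph : Set where
  field
    n     : ℕ
    m     : ℕ
    ends  : Fin m → Fin n × Fin n
    w     : Fin m → ℚ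
    w-pos : ∀ e → 0ℚ < w e

module _ (G : Graph) where
  open Graph G

  d : Fin m → ℚ
  d e = 1/_ (w e) {{>-nonZero (w-pos e)}}

  Joins : Fin m → Fin n → Fin n → Set
  Joins e u v = (ends e ≡ (u , v)) ⊎ (ends e ≡ (v , u))

  data Walk : Fin n → Fin n → Set where
    nil  : ∀ {a} → Walk a a
    step : ∀ {a b c} (e : Fin m) → Joins e a b → Walk b c → Walk a c

  len : ∀ {a b} → Walk a b → ℚ
  len nil            = 0ℚ
  len (step e _ p)   = d e + len p

  -- all vertices visited by the walk lie in U (i.e. a walk of the induced subgraph G(U))
  WalkIn : (Fin n → Set) → ∀ {a b} → Walk a b → Set
  WalkIn U {a} nil          = U a
  WalkIn U {a} (step e _ p) = U a × WalkIn U p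

  Connected : Set
  Connected = ∀ u v → Walk u v

  IsDistToSet : Subset n → Fin n → ℚ → Set
  IsDistToSet S u δ =
      (∃[ s ] (s ∈ S × Σ (Walk u s) λ p → len p ≡ δ))
    × (∀ s → s ∈ S → (p : Walk u s) → δ ≤ len p)

  IsMaxDist : (Fin n → ℚ) → ℚ → Set
  IsMaxDist dist ψ = (∃[ v ] dist v ≡ ψ) × (∀ v → dist v ≤ ψ)

  Forward : (Fin n → ℚ) → Fin m → Fin n → Fin n → Set
  Forward dist e u v = dist u + d e ≡ dist v

  -- The cost is defined as a relation,
  -- since whether a traversal is forward is a (ℚ-equality) proposition.
  data ConeCost (dist : Fin n → ℚ) : ∀ {a b} → Walk a b → ℚ → Set where
    cc-nil  : ∀ {a} → ConeCost dist {a} {a} nil 0ℚ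
    cc-fwd  : ∀ {a b c : Fin n} {e : Fin m} {j : Joins e a b} {p : Walk b c} {k : ℚ} →
              Forward dist e a b → ConeCost dist {b} {c} p k →
              ConeCost dist {a} {c} (step e j p) k
    cc-back : ∀ {a b c : Fin n} {e : Fin m} {j : Joins e a b} {p : Walk b c} {k : ℚ} →
              (Forward dist e a b → Data.Empty.⊥) → ConeCost dist {b} {c} p k →
              ConeCost dist {a} {c} (step e j p) (d e + k)

  InCone : (Fin n → ℚ) → ℚ → Fin n → Fin n → Set
  InCone dist l x u = Σ (Walk x u) λ p → ∃[ k ] (ConeCost dist p k × k ≤ l)

  RadAtMost : (Fin n → Set) → Fin n → ℚ → Set
  RadAtMost U x r = ∀ u → U u → Σ (Walk x u) λ p → WalkIn U p × len p ≤ r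

-- A forward edge raises dist(·, S) by exactly its length, while any other edge
-- lowers it by at most its length (triangle inequality).  Hence along a walk p
-- whose non-forward edges have total length k,
--   len p + dist(start, S) ≤ dist(end, S) + 2k.
-- Since dist(x, S) ≥ 0, a cone walk from x with k ≤ l therefore has length at
-- most ψ + 2l, and it stays inside C_S(l, x) because each of its prefixes is a
-- cone walk of smaller cost.
module Submission where

open import Defs
open import Data.Fin using (Fin)
open import Data.Fin.Subset using (Subset; _∈_)
open import Data.Rational using (ℚ; 0ℚ; _+_; _≤_; positive)
open import Data.Rational.Properties
open import Data.Rational.Solver using (module +-*-Solver)
open import Data.Product using (∃-syntax; _×_; _,_; proj₁; proj₂)
open import Relation.Binary.PropositionalEquality

open +-*-Solver using (solve; _:+_; _:=_)

+-nonNeg : ∀ {p q} → 0ℚ ≤ p → 0ℚ ≤ q → 0ℚ ≤ p + q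
+-nonNeg {p} {q} 0≤p 0≤q = subst (_≤ p + q) (+-identityʳ 0ℚ) (+-mono-≤ 0≤p 0≤q)

p≤p+q : ∀ p {q} → 0ℚ ≤ q → p ≤ p + q
p≤p+q p {q} 0≤q = subst (_≤ p + q) (+-identityʳ p) (+-monoʳ-≤ p 0≤q)

module _ (G : Graph) where
  open Graph G

  d-nonNeg : ∀ e → 0ℚ ≤ d G e
  d-nonNeg e = <⇒≤ (positive⁻¹ (d G e) {{1/pos⇒pos (w e) {{positive (w-pos e)}}}})

  len-nonNeg : ∀ {a b} (p : Walk G a b) → 0ℚ ≤ len G p
  len-nonNeg nil          = ≤-refl
  len-nonNeg (step e _ p) = +-nonNeg (d-nonNeg e) (len-nonNeg p)

  infixr 5 _++_
  _++_ : ∀ {a b c} → Walk G a b → Walk G b c → Walk G a c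
  nil        ++ q = q
  step e j p ++ q = step e j (p ++ q)

  module _ (dist : Fin n → ℚ) where

    coneCost-nonNeg : ∀ {a b} {p : Walk G a b} {k} → ConeCost G dist p k → 0ℚ ≤ k
    coneCost-nonNeg cc-nil                  = ≤-refl
    coneCost-nonNeg (cc-fwd _ c)            = coneCost-nonNeg c
    coneCost-nonNeg (cc-back {e = e} _ c)   = +-nonNeg (d-nonNeg e) (coneCost-nonNeg c)

    coneCost-++ : ∀ {a b c} {p : Walk G a b} {q : Walk G b c} {k₁ k₂} →
      ConeCost G dist p k₁ → ConeCost G dist q k₂ → ConeCost G dist (p ++ q) (k₁ + k₂)
    coneCost-++ {k₂ = k₂} cc-nil c =
      subst (ConeCost G dist _) (sym (+-identityˡ k₂)) c
    coneCost-++ (cc-fwd f c) c′ = cc-fwd f (coneCost-++ c c′)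
    coneCost-++ {k₂ = k₂} (cc-back {e = e} {k = k} f c) c′ =
      subst (ConeCost G dist _) (sym (+-assoc (d G e) k k₂)) (cc-back f (coneCost-++ c c′))

    coneCost-step : ∀ {a b c} {e} {j : Joins G e a b} {p : Walk G b c} {k} →
      ConeCost G dist (step e j p) k →
      ∃[ kₑ ] ∃[ k′ ] (ConeCost G dist (step e j nil) kₑ × ConeCost G dist p k′ × kₑ + k′ ≡ k)
    coneCost-step {k = k} (cc-fwd f c) = 0ℚ , k , cc-fwd f cc-nil , c , +-identityˡ k
    coneCost-step {e = e} (cc-back {k = k} f c) =
      d G e + 0ℚ , k , cc-back f cc-nil , c , cong (_+ k) (+-identityʳ (d G e))

    prefix-inCone : ∀ {l x a c} {q : Walk G x a} {k₀} → ConeCost G dist q k₀ →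
      {p : Walk G a c} {k : ℚ} → ConeCost G dist p k → k₀ + k ≤ l →
      InCone G dist l x a
    prefix-inCone {q = q} {k₀} cq cp k₀+k≤l =
      q , k₀ , cq , ≤-trans (p≤p+q k₀ (coneCost-nonNeg cp)) k₀+k≤l

    coneWalk-inCone : ∀ {l x a c} (q : Walk G x a) {k₀} → ConeCost G dist q k₀ →
      (p : Walk G a c) {k : ℚ} → ConeCost G dist p k → k₀ + k ≤ l →
      WalkIn G (InCone G dist l x) p
    coneWalk-inCone q cq nil cp k₀+k≤l = prefix-inCone cq cp k₀+k≤l
    coneWalk-inCone {l} q {k₀} cq (step e j p) cp k₀+k≤l with coneCost-step cp
    ... | kₑ , k′ , ce , cp′ , kₑ+k′≡k =
      prefix-inCone cq cp k₀+k≤l ,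
      coneWalk-inCone (q ++ step e j nil) (coneCost-++ cq ce) p cp′
        (subst (_≤ l) (trans (cong (k₀ +_) (sym kₑ+k′≡k)) (sym (+-assoc k₀ kₑ k′))) k₀+k≤l)

    module _ (S : Subset n) (isDist : ∀ u → IsDistToSet G S u (dist u)) where

      dist-nonNeg : ∀ u → 0ℚ ≤ dist u
      dist-nonNeg u with proj₁ (isDist u)
      ... | _ , _ , p , len≡dist = subst (0ℚ ≤_) len≡dist (len-nonNeg p)

      dist-triangle : ∀ {a b} e → Joins G e a b → dist a ≤ d G e + dist b
      dist-triangle {a} e j with proj₁ (isDist _)
      ... | s , s∈S , q , len≡dist =
        subst (dist a ≤_) (cong (d G e +_) len≡dist) (proj₂ (isDist a) s s∈S (step e j q))

      len+dist≤dist+2coneCost : ∀ {a c} {p : Walk G a c} {k} → ConeCost G dist p k →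
        len G p + dist a ≤ dist c + (k + k)
      len+dist≤dist+2coneCost {a} cc-nil = ≤-reflexive (begin
        0ℚ + dist a          ≡⟨ +-comm 0ℚ (dist a) ⟩
        dist a + 0ℚ          ≡⟨ cong (dist a +_) (sym (+-identityʳ 0ℚ)) ⟩
        dist a + (0ℚ + 0ℚ)   ∎)
        where open ≡-Reasoning
      len+dist≤dist+2coneCost {a} {c} {step e _ p} {k} (cc-fwd fwd cp) = begin
        (d G e + len G p) + dist a   ≡⟨ shuffle (d G e) (len G p) (dist a) ⟩
        len G p + (dist a + d G e)   ≡⟨ cong (len G p +_) fwd ⟩
        len G p + dist _             ≤⟨ len+dist≤dist+2coneCost cp ⟩
        dist c + (k + k)             ∎
        where
          open ≤-Reasoning
          shuffle : ∀ x y z → (x + y) + z ≡ y + (z + x)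
          shuffle = solve 3 (λ x y z → (x :+ y) :+ z := y :+ (z :+ x)) refl
      len+dist≤dist+2coneCost {a} {c} {step e j p} (cc-back {k = k} _ cp) = begin
        (d G e + len G p) + dist a              ≤⟨ +-monoʳ-≤ (d G e + len G p) (dist-triangle e j) ⟩
        (d G e + len G p) + (d G e + dist _)    ≡⟨ shuffle₁ (d G e) (len G p) (dist _) ⟩
        (d G e + d G e) + (len G p + dist _)    ≤⟨ +-monoʳ-≤ (d G e + d G e) (len+dist≤dist+2coneCost cp) ⟩
        (d G e + d G e) + (dist c + (k + k))    ≡⟨ shuffle₂ (d G e) (dist c) k ⟩
        dist c + ((d G e + k) + (d G e + k))    ∎
        where
          open ≤-Reasoning
          shuffle₁ : ∀ x y z → (x + y) + (x + z) ≡ (x + x) + (y + z)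
          shuffle₁ = solve 3 (λ x y z → (x :+ y) :+ (x :+ z) := (x :+ x) :+ (y :+ z)) refl
          shuffle₂ : ∀ x y z → (x + x) + (y + (z + z)) ≡ y + ((x + z) + (x + z))
          shuffle₂ = solve 3 (λ x y z → (x :+ x) :+ (y :+ (z :+ z)) := y :+ ((x :+ z) :+ (x :+ z))) refl

mainTheorem8 : (G : Graph) → Connected G →
    (S : Subset (Graph.n G)) →
    (dist : Fin (Graph.n G) → ℚ) → (∀ u → IsDistToSet G S u (dist u)) →
    (ψ : ℚ) → IsMaxDist G dist ψ →
    ∀ x → x ∈ S → (l : ℚ) → 0ℚ ≤ l →
    RadAtMost G (InCone G dist l x) x (ψ + (l + l))
mainTheorem8 G _ S dist isDist ψ (_ , dist≤ψ) x x∈S l _ u (p , k , cp , k≤l) =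
  p , coneWalk-inCone G dist nil cc-nil p cp (subst (_≤ l) (sym (+-identityˡ k)) k≤l) , len≤ψ+2l
  where
    open ≤-Reasoning
    len≤ψ+2l : len G p ≤ ψ + (l + l)
    len≤ψ+2l = begin
      len G p            ≤⟨ p≤p+q (len G p) (dist-nonNeg G dist S isDist x) ⟩
      len G p + dist x   ≤⟨ len+dist≤dist+2coneCost G dist S isDist cp ⟩
      dist u + (k + k)   ≤⟨ +-mono-≤ (dist≤ψ u) (+-mono-≤ k≤l k≤l) ⟩
      ψ + (l + l)        ∎
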